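{- Let $G_1$ be the graph consisting of a $5$-cycle $v_1v_2v_3v_4v_5$ (edges $v_1v_2,v_2v_3,v_3v_4,v_4v_5,v_5v_1$) together with a path $v_1xyv_3$ (two new vertices $x,y$ and edges $v_1x,xy,yv_3$). Let $L_1(v_1)=L_1(v_3)=\{1,\dots,6\}$, $L_1(v_2)=\{1,4,5,6\}$, $L_1(v_4)=\{3,4,5,6\}$, $L_1(v_5)=\{2,4,5,6\}$, $L_1(x)=\{1,2,3,4\}$, $L_1(y)=\{1,2\}$. Then $G_1$ is $L$-colorable for every half-list assignment $L$ (with respect to $L_1$) such that $L(v_1)=L(v_3)$, but $G_1$ is not $(L_1:2)$-colorable.
   Context: A list assignment $L$ for a graph $G$ assigns to each vertex $v$ a set $L(v)$ of colors. An $L$-coloring is a proper vertex coloring $c$ with $c(v)\in L(v)$ for all $v$. An $(L:2)$-coloring assigns to each vertex $v$ a $2$-element subset $\varphi(v)\subseteq L(v)$ such that adjacent vertices receive disjoint sets. Given a list assignment $L_1$ with all lists of even size, a half-list assignment (with respect to $L_1$) is any list assignment $L$ with $|L(v)|=|L_1(v)|/2$ for every vertex $v$ (the sets $L(v)$ are arbitrary sets of colors of that size). -}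

module Defs where

open import Data.Nat using (ℕ; _/_)
open import Data.Fin using (Fin; zero; suc)
open import Data.List using (List; []; _∷_; length)
open import Data.List.Membership.Propositional using (_∈_)
open import Data.List.Relation.Unary.Unique.Propositional using (Unique)
open import Data.Product using (_×_; Σ; _,_)
open import Data.Sum using (_⊎_)
open import Relation.Binary.PropositionalEquality using (_≡_; _≢_)
open import Relation.Nullary using (¬_)

V : Set
V = Fin 7

v1 v2 v3 v4 v5 vx vy : V
v1 = zero
v2 = suc zero
v3 = suc (suc zero)
v4 = suc (suc (suc zero))
v5 = suc (suc (suc (suc zero)))
vx = suc (suc (suc (suc (suc zero))))
vy = suc (suc (suc (suc (suc (suc zero)))))

data Edge : V → V → Set where
  e12 : Edge v1 v2
  e23 : Edge v2 v3
  e34 : Edge v3 v4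
  e45 : Edge v4 v5
  e51 : Edge v5 v1
  e1x : Edge v1 vx
  exy : Edge vx vy
  ey3 : Edge vy v3

Adj : V → V → Set
Adj u w = Edge u w ⊎ Edge w u

ListAssignment : Set
ListAssignment = V → List ℕ

L₁ : ListAssignment
L₁ zero = 1 ∷ 2 ∷ 3 ∷ 4 ∷ 5 ∷ 6 ∷ []
L₁ (suc zero) = 1 ∷ 4 ∷ 5 ∷ 6 ∷ []
L₁ (suc (suc zero)) = 1 ∷ 2 ∷ 3 ∷ 4 ∷ 5 ∷ 6 ∷ []
L₁ (suc (suc (suc zero))) = 3 ∷ 4 ∷ 5 ∷ 6 ∷ []
L₁ (suc (suc (suc (suc zero)))) = 2 ∷ 4 ∷ 5 ∷ 6 ∷ []
L₁ (suc (suc (suc (suc (suc zero))))) = 1 ∷ 2 ∷ 3 ∷ 4 ∷ []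
L₁ (suc (suc (suc (suc (suc (suc zero)))))) = 1 ∷ 2 ∷ []

-- L is a half-list assignment w.r.t. L₁: every L(v) is a set (no repeated
-- colors) of size |L₁(v)|/2 (all |L₁(v)| are even).
IsHalfListAssignment : ListAssignment → Set
IsHalfListAssignment L = ∀ v → Unique (L v) × length (L v) ≡ length (L₁ v) / 2

SameSet : List ℕ → List ℕ → Set
SameSet A B = (∀ c → c ∈ A → c ∈ B) × (∀ c → c ∈ B → c ∈ A)

IsLColoring : ListAssignment → (V → ℕ) → Set
IsLColoring L c = (∀ v → c v ∈ L v) × (∀ u w → Adj u w → c u ≢ c w)

LColorable : ListAssignment → Set
LColorable L = Σ (V → ℕ) (IsLColoring L)

TwoSet : Set
TwoSet = ℕ × ℕ

_∈₂_ : ℕ → TwoSet → Set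
c ∈₂ (a , b) = (c ≡ a) ⊎ (c ≡ b)

IsL2Coloring : ListAssignment → (V → TwoSet) → Set
IsL2Coloring L φ =
  (∀ v → Σ ℕ λ a → Σ ℕ λ b → φ v ≡ (a , b) × a ≢ b × a ∈ L v × b ∈ L v)
  × (∀ u w → Adj u w → ∀ c → c ∈₂ φ u → ¬ (c ∈₂ φ w))

L2Colorable : ListAssignment → Set
L2Colorable L = Σ (V → TwoSet) (IsL2Coloring L)

module Submission where

-- y has a single colour cy; give x a colour cx ≠ cy. On the remaining 5-cycle v1 must avoid cx
-- and v3 must avoid cy, and since L(v1) = L(v3) has three colours some α in it avoids both.
-- Colouring v1 and v3 by α leaves a colour for v2, and the path v4 v5 extends unless
-- L(v4) = L(v5) = {α, d}; then (α, c₂, p, α, d) or (cy, c₂, α, d, α) colours v1 … v5 for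
-- a suitable p ∈ L(v1). Each choice is one pigeonhole step: a duplicate-free list has an element
-- outside any shorter list. The failure of (L₁:2)-colourability is a finite search.

open import Defs
open import Data.Nat using (ℕ; _≤_; _<_; _≟_; _/_; s≤s⁻¹)
open import Data.Nat.Properties using (≤-refl)
open import Data.Fin using (zero; suc)
open import Data.List using (List; []; _∷_; length; cartesianProduct)
open import Data.List.Properties using (length-removeAt′)
open import Data.List.Membership.Propositional using (_∈_)
open import Data.List.Membership.Propositional.Properties using (∈-cartesianProduct⁺)
open import Data.List.Relation.Unary.All using (All; []; _∷_; all?)
import Data.List.Relation.Unary.All as All
open import Data.List.Relation.Unary.All.Properties using (¬Any⇒All¬; ─⁻)
open import Data.List.Relation.Unary.Any using (here; there; _─_)
import Data.List.Relation.Unary.Any as Any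
open import Data.List.Relation.Unary.Any.Properties using (lookup-result)
open import Data.List.Relation.Unary.Unique.Propositional using (Unique; _∷_)
open import Data.Product using (∃-syntax; _×_; _,_; proj₁; proj₂)
open import Data.Sum using (inj₁; inj₂)
open import Relation.Binary.Definitions using (DecidableEquality)
open import Relation.Binary.PropositionalEquality using (_≢_; refl; sym; trans; subst; ≢-sym)
open import Relation.Nullary using (¬_; Dec; yes; no; ¬?; _×-dec_; _→-dec_; _⊎-dec_)
open import Relation.Nullary.Decidable using (toWitness)

module _ {a} {A : Set a} (_≟_ : DecidableEquality A) where

  open import Data.List.Membership.DecPropositional _≟_ using (_∈?_)

  ∃-fresh-∈ : ∀ {xs : List A} (ys : List A) → Unique xs → length ys < length xs →
              ∃[ x ] x ∈ xs × All (x ≢_) ys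
  ∃-fresh-∈ {x ∷ xs} ys (x≢xs ∷ !xs) |ys|<|xs|+1 with x ∈? ys
  ... | no x∉ys = x , here refl , ¬Any⇒All¬ ys x∉ys
  ... | yes x∈ys with ∃-fresh-∈ (ys ─ x∈ys) !xs shorter
    where
    shorter : length (ys ─ x∈ys) < length xs
    shorter = subst (_≤ length xs) (length-removeAt′ ys _) (s≤s⁻¹ |ys|<|xs|+1)
  ...   | z , z∈xs , z∉ys─x = z , there z∈xs , ─⁻ x∈ys z≢x z∉ys─x
    where
    z≢x : z ≢ Any.lookup x∈ys
    z≢x = λ z≡ → All.lookup x≢xs z∈xs (trans (lookup-result x∈ys) (sym z≡))

module HalfListColouring (L : ListAssignment) (half : IsHalfListAssignment L)
                         (L₁≈L₃ : SameSet (L v1) (L v3)) where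

  pick : ∀ v (ys : List ℕ) → length ys < length (L₁ v) / 2 → ∃[ c ] c ∈ L v × All (c ≢_) ys
  pick v ys short =
    ∃-fresh-∈ _≟_ ys (proj₁ (half v)) (subst (length ys <_) (sym (proj₂ (half v))) short)

  -- c₃ is drawn from L v1, which has the same elements as L v3.
  record CycleColouring (cx cy : ℕ) : Set where
    field
      c₁ c₂ c₃ c₄ c₅ : ℕ
      c₁∈ : c₁ ∈ L v1
      c₂∈ : c₂ ∈ L v2
      c₃∈ : c₃ ∈ L v1
      c₄∈ : c₄ ∈ L v4
      c₅∈ : c₅ ∈ L v5
      c₁≢c₂ : c₁ ≢ c₂
      c₂≢c₃ : c₂ ≢ c₃
      c₃≢c₄ : c₃ ≢ c₄
      c₄≢c₅ : c₄ ≢ c₅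
      c₅≢c₁ : c₅ ≢ c₁
      c₁≢cx : c₁ ≢ cx
      c₃≢cy : c₃ ≢ cy

  extend : ∀ {cx cy} → cx ∈ L vx → cy ∈ L vy → cx ≢ cy → CycleColouring cx cy → LColorable L
  extend {cx} {cy} cx∈ cy∈ cx≢cy κ = colour , colour∈L , proper
    where
    open CycleColouring κ
    colour : V → ℕ
    colour zero                                   = c₁
    colour (suc zero)                             = c₂
    colour (suc (suc zero))                       = c₃
    colour (suc (suc (suc zero)))                 = c₄
    colour (suc (suc (suc (suc zero))))           = c₅
    colour (suc (suc (suc (suc (suc zero)))))     = cx
    colour (suc (suc (suc (suc (suc (suc zero)))))) = cy
    colour∈L : ∀ v → colour v ∈ L v
    colour∈L zero                                   = c₁∈
    colour∈L (suc zero)                             = c₂∈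
    colour∈L (suc (suc zero))                       = proj₁ L₁≈L₃ c₃ c₃∈
    colour∈L (suc (suc (suc zero)))                 = c₄∈
    colour∈L (suc (suc (suc (suc zero))))           = c₅∈
    colour∈L (suc (suc (suc (suc (suc zero)))))     = cx∈
    colour∈L (suc (suc (suc (suc (suc (suc zero)))))) = cy∈
    edge : ∀ {u w} → Edge u w → colour u ≢ colour w
    edge e12 = c₁≢c₂
    edge e23 = c₂≢c₃
    edge e34 = c₃≢c₄
    edge e45 = c₄≢c₅
    edge e51 = c₅≢c₁
    edge e1x = c₁≢cx
    edge exy = cx≢cy
    edge ey3 = ≢-sym c₃≢cy
    proper : ∀ u w → Adj u w → colour u ≢ colour w
    proper _ _ (inj₁ e) = edge e
    proper _ _ (inj₂ e) = ≢-sym (edge e)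

  data Path₄₅ (α : ℕ) : Set where
    avoiding : ∀ {c₄ c₅} → c₄ ∈ L v4 → c₅ ∈ L v5 → c₄ ≢ α → c₅ ≢ α → c₄ ≢ c₅ → Path₄₅ α
    pinned   : ∀ {d} → d ≢ α → α ∈ L v4 → d ∈ L v4 → α ∈ L v5 → d ∈ L v5 → Path₄₅ α

  path₄₅ : ∀ α → Path₄₅ α
  path₄₅ α with pick v4 (α ∷ []) ≤-refl
  ... | d , d∈₄ , d≢α ∷ [] with pick v5 (d ∷ []) ≤-refl
  ... | e , e∈₅ , e≢d ∷ [] with e ≟ α
  ... | no e≢α = avoiding d∈₄ e∈₅ d≢α e≢α (≢-sym e≢d)
  ... | yes refl with pick v5 (α ∷ []) ≤-refl
  ... | e′ , e′∈₅ , e′≢α ∷ [] with e′ ≟ d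
  ... | no e′≢d = avoiding d∈₄ e′∈₅ d≢α e′≢α (≢-sym e′≢d)
  ... | yes refl with pick v4 (d ∷ []) ≤-refl
  ... | d′ , d′∈₄ , d′≢d ∷ [] with d′ ≟ α
  ... | no d′≢α = avoiding d′∈₄ e′∈₅ d′≢α d≢α d′≢d
  ... | yes refl = pinned d≢α d′∈₄ d∈₄ e∈₅ e′∈₅

  module _ {cx cy : ℕ} (cx≢cy : cx ≢ cy) where

    module _ {α c₂ : ℕ} (α∈ : α ∈ L v1) (α≢cx : α ≢ cx) (α≢cy : α ≢ cy)
             (c₂∈ : c₂ ∈ L v2) (c₂≢α : c₂ ≢ α) where

      α-on-v₁v₃ : ∀ {c₄ c₅} → c₄ ∈ L v4 → c₅ ∈ L v5 → c₄ ≢ α → c₅ ≢ α → c₄ ≢ c₅ →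
                  CycleColouring cx cy
      α-on-v₁v₃ c₄∈ c₅∈ c₄≢α c₅≢α c₄≢c₅ = record
        { c₁∈ = α∈ ; c₂∈ = c₂∈ ; c₃∈ = α∈ ; c₄∈ = c₄∈ ; c₅∈ = c₅∈
        ; c₁≢c₂ = ≢-sym c₂≢α ; c₂≢c₃ = c₂≢α ; c₃≢c₄ = ≢-sym c₄≢α ; c₄≢c₅ = c₄≢c₅ ; c₅≢c₁ = c₅≢α
        ; c₁≢cx = α≢cx ; c₃≢cy = α≢cy }

      α-on-v₁v₄ : ∀ {p d} → p ∈ L v1 → p ≢ α → p ≢ c₂ → p ≢ cy → α ∈ L v4 → d ∈ L v5 → d ≢ α →
                  CycleColouring cx cy
      α-on-v₁v₄ p∈ p≢α p≢c₂ p≢cy α∈₄ d∈₅ d≢α = record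
        { c₁∈ = α∈ ; c₂∈ = c₂∈ ; c₃∈ = p∈ ; c₄∈ = α∈₄ ; c₅∈ = d∈₅
        ; c₁≢c₂ = ≢-sym c₂≢α ; c₂≢c₃ = ≢-sym p≢c₂ ; c₃≢c₄ = p≢α ; c₄≢c₅ = ≢-sym d≢α ; c₅≢c₁ = d≢α
        ; c₁≢cx = α≢cx ; c₃≢cy = p≢cy }

      α-on-v₃v₅ : ∀ {d} → cy ∈ L v1 → cy ≢ α → cy ≢ c₂ → d ∈ L v4 → α ∈ L v5 → d ≢ α →
                  CycleColouring cx cy
      α-on-v₃v₅ cy∈ cy≢α cy≢c₂ d∈₄ α∈₅ d≢α = record
        { c₁∈ = cy∈ ; c₂∈ = c₂∈ ; c₃∈ = α∈ ; c₄∈ = d∈₄ ; c₅∈ = α∈₅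
        ; c₁≢c₂ = cy≢c₂ ; c₂≢c₃ = c₂≢α ; c₃≢c₄ = ≢-sym d≢α ; c₄≢c₅ = d≢α ; c₅≢c₁ = ≢-sym cy≢α
        ; c₁≢cx = ≢-sym cx≢cy ; c₃≢cy = α≢cy }

      pinned-colouring : ∀ {d} → d ≢ α → α ∈ L v4 → d ∈ L v4 → α ∈ L v5 → d ∈ L v5 →
                         CycleColouring cx cy
      pinned-colouring d≢α α∈₄ d∈₄ α∈₅ d∈₅ with pick v1 (α ∷ cy ∷ []) ≤-refl
      ... | p , p∈ , p≢α ∷ p≢cy ∷ [] with p ≟ c₂
      ... | no p≢c₂ = α-on-v₁v₄ p∈ p≢α p≢c₂ p≢cy α∈₄ d∈₅ d≢α
      ... | yes refl with pick v1 (α ∷ c₂ ∷ []) ≤-refl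
      ... | q , q∈ , q≢α ∷ q≢c₂ ∷ [] with q ≟ cy
      ... | no q≢cy = α-on-v₁v₄ q∈ q≢α q≢c₂ q≢cy α∈₄ d∈₅ d≢α
      ... | yes refl = α-on-v₃v₅ q∈ q≢α q≢c₂ d∈₄ α∈₅ d≢α

    cycle-colouring : CycleColouring cx cy
    cycle-colouring with pick v1 (cx ∷ cy ∷ []) ≤-refl
    ... | α , α∈ , α≢cx ∷ α≢cy ∷ [] with pick v2 (α ∷ []) ≤-refl
    ... | c₂ , c₂∈ , c₂≢α ∷ [] with path₄₅ α
    ... | avoiding c₄∈ c₅∈ c₄≢α c₅≢α c₄≢c₅ = α-on-v₁v₃ α∈ α≢cx α≢cy c₂∈ c₂≢α c₄∈ c₅∈ c₄≢α c₅≢α c₄≢c₅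
    ... | pinned d≢α α∈₄ d∈₄ α∈₅ d∈₅ = pinned-colouring α∈ α≢cx α≢cy c₂∈ c₂≢α d≢α α∈₄ d∈₄ α∈₅ d∈₅

  colourable : LColorable L
  colourable with pick vy [] ≤-refl
  ... | cy , cy∈ , [] with pick vx (cy ∷ []) ≤-refl
  ... | cx , cx∈ , cx≢cy ∷ [] = extend cx∈ cy∈ cx≢cy (cycle-colouring cx≢cy)

Distinct : TwoSet → Set
Distinct (a , b) = a ≢ b

distinct? : ∀ p → Dec (Distinct p)
distinct? (a , b) = ¬? (a ≟ b)

Disjoint₂ : TwoSet → TwoSet → Set
Disjoint₂ (a , b) q = ¬ a ∈₂ q × ¬ b ∈₂ q

disjoint₂? : ∀ p q → Dec (Disjoint₂ p q)
disjoint₂? (a , b) (c , d) = ¬? (a ≟ c ⊎-dec a ≟ d) ×-dec ¬? (b ≟ c ⊎-dec b ≟ d)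

choices : ListAssignment → V → List TwoSet
choices L v = cartesianProduct (L v) (L v)

-- The search tree: 2-sets for y, x, v1, …, v5 in turn, each disjoint from those of its earlier
-- neighbours, always clash at the edge v5 v1.
NoL₁∶2-colouring : Set
NoL₁∶2-colouring =
  All (λ py → Distinct py →
  All (λ px → Distinct px → Disjoint₂ px py →
  All (λ p₁ → Distinct p₁ → Disjoint₂ p₁ px →
  All (λ p₂ → Distinct p₂ → Disjoint₂ p₂ p₁ →
  All (λ p₃ → Distinct p₃ → Disjoint₂ p₃ p₂ → Disjoint₂ p₃ py →
  All (λ p₄ → Distinct p₄ → Disjoint₂ p₄ p₃ →
  All (λ p₅ → Distinct p₅ → Disjoint₂ p₅ p₄ → ¬ Disjoint₂ p₅ p₁)
    (choices L₁ v5)) (choices L₁ v4)) (choices L₁ v3)) (choices L₁ v2)) (choices L₁ v1)) (choices L₁ vx)) (choices L₁ vy)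

noL₁∶2-colouring? : Dec NoL₁∶2-colouring
noL₁∶2-colouring? =
  all? (λ py → distinct? py →-dec
  all? (λ px → distinct? px →-dec disjoint₂? px py →-dec
  all? (λ p₁ → distinct? p₁ →-dec disjoint₂? p₁ px →-dec
  all? (λ p₂ → distinct? p₂ →-dec disjoint₂? p₂ p₁ →-dec
  all? (λ p₃ → distinct? p₃ →-dec disjoint₂? p₃ p₂ →-dec disjoint₂? p₃ py →-dec
  all? (λ p₄ → distinct? p₄ →-dec disjoint₂? p₄ p₃ →-dec
  all? (λ p₅ → distinct? p₅ →-dec disjoint₂? p₅ p₄ →-dec ¬? (disjoint₂? p₅ p₁))
    (choices L₁ v5)) (choices L₁ v4)) (choices L₁ v3)) (choices L₁ v2)) (choices L₁ v1)) (choices L₁ vx)) (choices L₁ vy)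

noL₁∶2-colouring : NoL₁∶2-colouring
noL₁∶2-colouring = toWitness {a? = noL₁∶2-colouring?} _

module _ {L : ListAssignment} {φ : V → TwoSet} (col : IsL2Coloring L φ) where

  chosen : ∀ v → φ v ∈ choices L v × Distinct (φ v)
  chosen v with φ v | proj₁ col v
  ... | _ | a , b , refl , a≢b , a∈ , b∈ = ∈-cartesianProduct⁺ a∈ b∈ , a≢b

  apart : ∀ {u w} → Adj u w → Disjoint₂ (φ u) (φ w)
  apart {u} {w} adj with φ u | proj₂ col u w adj
  ... | a , b | disjoint = disjoint a (inj₁ refl) , disjoint b (inj₂ refl)

¬L₁∶2-colourable : ¬ L2Colorable L₁
¬L₁∶2-colourable (φ , col) = blocked (apart col (inj₁ e51))
  where
  at : ∀ {P : TwoSet → Set} v → All (λ p → Distinct p → P p) (choices L₁ v) → P (φ v)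
  at v ps = All.lookup ps (proj₁ (chosen col v)) (proj₂ (chosen col v))
  blocked : ¬ Disjoint₂ (φ v5) (φ v1)
  blocked =
    at v5 (at v4 (at v3 (at v2 (at v1 (at vx (at vy noL₁∶2-colouring)
      (apart col (inj₁ exy)))
      (apart col (inj₁ e1x)))
      (apart col (inj₂ e12)))
      (apart col (inj₂ e23)) (apart col (inj₂ ey3)))
      (apart col (inj₂ e34)))
      (apart col (inj₂ e45))

corollary4 : ((L : ListAssignment) → IsHalfListAssignment L → SameSet (L v1) (L v3) → LColorable L)
               × ¬ L2Colorable L₁
corollary4 = HalfListColouring.colourable , ¬L₁∶2-colourable
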